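{- Let $d\ge1$, let $S_1,\ldots,S_d$ be numerical semigroups different from $\mathbb{N}$, and let $S=\mathbb{N}^d\setminus\bigcup_{i=1}^d\{h\mathbf{e}_i:h\in\operatorname{H}(S_i)\}$. Then (1) $S$ is quasi-irreducible if and only if $S_i$ is irreducible for all $i\in\{1,\ldots,d\}$; (2) $S$ is quasi-symmetric if and only if $S_i$ is symmetric for all $i\in\{1,\ldots,d\}$.
   Context: $\mathbf{e}_i$ are standard basis vectors; $\le$ is the componentwise partial order on $\mathbb{N}^d$. For a GNS $S\subseteq\mathbb{N}^d$ (submonoid with finite complement $\operatorname{H}(S)$): $\operatorname{FA}(S)$ is the set of $\le$-maximal elements of $\operatorname{H}(S)$, $\tau(S)=|\operatorname{FA}(S)|$; $\operatorname{PF}(S)=\{\mathbf{x}\in\operatorname{H}(S):\mathbf{x}+\mathbf{s}\in S\ \forall\mathbf{s}\in S\setminus\{\mathbf{0}\}\}$, $\operatorname{t}(S)=|\operatorname{PF}(S)|$. $S$ is quasi-irreducible if for every $\mathbf{x}\in\operatorname{H}(S)$ either $2\mathbf{x}\in\operatorname{FA}(S)$ or there is $\mathbf{F}\in\operatorname{FA}(S)$ with $\mathbf{F}-\mathbf{x}\in S$; $S$ is quasi-symmetric if $\tau(S)=\operatorname{t}(S)$. For a numerical semigroup $T$ with Frobenius number $\operatorname{F}(T)=\max(\mathbb{Z}\setminus T)$ and special gaps $\operatorname{SG}(T)=\{x\in\operatorname{PF}(T):2x\in T\}$: $T$ is irreducible if it is not the intersection of two numerical semigroups properly containing it, equivalently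 $\operatorname{SG}(T)=\{\operatorname{F}(T)\}$; $T$ is symmetric if $\operatorname{PF}(T)=\{\operatorname{F}(T)\}$. -}

module Defs where

open import Data.Nat using (ℕ; zero; suc; _+_; _∸_; _≤_)
open import Data.Bool using (Bool; true; false; _∧_)
open import Data.Fin using (Fin)
open import Data.Vec using (Vec; replicate; lookup; zipWith; _[_]≔_)
open import Data.List using (List; length)
open import Data.List.Relation.Unary.Unique.Propositional using (Unique)
open import Data.List.Membership.Propositional using (_∈_)
open import Data.Product using (Σ; ∃; ∃-syntax; _×_)
open import Data.Sum using (_⊎_)
open import Relation.Nullary using (¬_)
open import Relation.Binary.PropositionalEquality using (_≡_; _≢_)
open import Function.Bundles using (_⇔_)

record NumericalSemigroup : Set where
  field
    mem      : ℕ → Bool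
    zero-mem : mem 0 ≡ true
    +-closed : ∀ a b → mem a ≡ true → mem b ≡ true → mem (a + b) ≡ true
    cofinite : Σ ℕ λ N → ∀ n → N ≤ n → mem n ≡ true
open NumericalSemigroup public

module _ (T : NumericalSemigroup) where

  Gap : ℕ → Set
  Gap x = mem T x ≡ false

  NotAllℕ : Set
  NotAllℕ = ∃[ n ] Gap n

  PseudoFrobenius : ℕ → Set
  PseudoFrobenius x = Gap x × (∀ s → mem T s ≡ true → s ≢ 0 → mem T (x + s) ≡ true)

  -- f = F(T) = max(ℤ ∖ T)  (for T ≠ ℕ this is the largest gap in ℕ)
  IsFrobenius : ℕ → Set
  IsFrobenius f = Gap f × (∀ x → Gap x → x ≤ f)

  Symmetric : Set
  Symmetric = Σ ℕ λ f → IsFrobenius f × (∀ x → PseudoFrobenius x ⇔ (x ≡ f))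

_⊂NS_ : NumericalSemigroup → NumericalSemigroup → Set
T ⊂NS T' = (∀ n → mem T n ≡ true → mem T' n ≡ true)
         × (∃[ n ] (mem T' n ≡ true × mem T n ≡ false))

Irreducible : NumericalSemigroup → Set
Irreducible T = ¬ (Σ NumericalSemigroup λ T₁ → Σ NumericalSemigroup λ T₂ →
                     T ⊂NS T₁ × T ⊂NS T₂ ×
                     (∀ n → mem T n ≡ (mem T₁ n ∧ mem T₂ n)))

_≤ᵥ_ : ∀ {d} → Vec ℕ d → Vec ℕ d → Set
x ≤ᵥ y = ∀ i → lookup x i ≤ lookup y i

_+ᵥ_ : ∀ {d} → Vec ℕ d → Vec ℕ d → Vec ℕ d
_+ᵥ_ = zipWith _+_

_∸ᵥ_ : ∀ {d} → Vec ℕ d → Vec ℕ d → Vec ℕ d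
_∸ᵥ_ = zipWith _∸_

0ᵥ : ∀ {d} → Vec ℕ d
0ᵥ {d} = replicate d 0

_·e_ : ∀ {d} → ℕ → Fin d → Vec ℕ d
h ·e i = 0ᵥ [ i ]≔ h

HasCard : ∀ {d} → (Vec ℕ d → Set) → ℕ → Set
HasCard {d} P n = Σ (List (Vec ℕ d)) λ l → Unique l × (∀ x → (x ∈ l) ⇔ P x) × length l ≡ n

module _ {d : ℕ} (S : Vec ℕ d → Set) where

  GapV : Vec ℕ d → Set
  GapV x = ¬ S x

  FA : Vec ℕ d → Set
  FA x = GapV x × (∀ y → GapV y → x ≤ᵥ y → y ≡ x)

  PF : Vec ℕ d → Set
  PF x = GapV x × (∀ s → S s → s ≢ 0ᵥ → S (x +ᵥ s))

  -- quasi-irreducible; "F - x ∈ S" (with F - x taken in ℤ^d) means x ≤ F and F ∸ x ∈ S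
  QuasiIrreducible : Set
  QuasiIrreducible = ∀ x → GapV x →
    FA (x +ᵥ x) ⊎ (Σ (Vec ℕ d) λ F → FA F × x ≤ᵥ F × S (F ∸ᵥ x))

  QuasiSymmetric : Set
  QuasiSymmetric = Σ ℕ λ n → HasCard FA n × HasCard PF n

SemigroupFrom : ∀ {d} → (Fin d → NumericalSemigroup) → Vec ℕ d → Set
SemigroupFrom {d} T x = ¬ (Σ (Fin d) λ i → Σ ℕ λ h → Gap (T i) h × x ≡ h ·e i)

{-# OPTIONS --safe #-}
module Submission where

-- The gaps of S are exactly the points h eᵢ with h a gap of Sᵢ.
-- Hence the maximal gaps of S are the F(Sᵢ) eᵢ, and h eᵢ is pseudo-Frobenius in S iff h is
-- pseudo-Frobenius in Sᵢ. Quasi-irreducibility of S thus says that every gap h of each Sᵢ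
-- satisfies 2h = F(Sᵢ) or F(Sᵢ) − h ∈ Sᵢ, the classical characterisation of irreducibility:
-- if T = T₁ ∩ T₂ properly, the largest element of Tⱼ ∖ T is a special gap, which the criterion
-- forces to be F(T) for both j; conversely, the largest gap h with 2h ≠ F(T) and F(T) − h ∉ T
-- is a special gap x ≠ F(T), and then T = (T ∪ {x}) ∩ (T ∪ {F(T)}). Finally τ(S) = d always,
-- while t(S) = d iff PF(Sᵢ) = {F(Sᵢ)} for every i.

open import Defs
open import Data.Bool using (Bool; true; false; _∧_; _∨_)
open import Data.Bool.Properties using (∨-zeroʳ; ¬-not; not-¬) renaming (_≟_ to _≟ᵇ_)
open import Data.Empty using (⊥-elim)
open import Data.Fin using (Fin; zero; suc) renaming (_≟_ to _≟ᶠ_)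
open import Data.Fin.Properties using (any?; injective⇒≤)
open import Data.List using (List; _∷_; length; tabulate) renaming (lookup to lookupˡ)
open import Data.List.Properties using (length-tabulate)
open import Data.List.Membership.Propositional using (_∈_)
open import Data.List.Membership.Propositional.Properties using (∈-tabulate⁺; ∈-tabulate⁻; ∈-lookup)
open import Data.List.Membership.Setoid.Properties using (index-injective)
open import Data.List.Relation.Unary.All using () renaming (lookup to lookupᴬ)
open import Data.List.Relation.Unary.AllPairs using (_∷_)
open import Data.List.Relation.Unary.Any using (index)
open import Data.List.Relation.Unary.Unique.Propositional using (Unique)
open import Data.List.Relation.Unary.Unique.Propositional.Properties using (tabulate⁺)
open import Data.Nat using (ℕ; zero; suc; _+_; _∸_; _≤_; _<_; z≤n; _≟_)
open import Data.Nat.Properties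
open import Data.Product using (Σ; ∃; ∃-syntax; _×_; _,_; proj₁; proj₂)
open import Data.Sum using (_⊎_; inj₁; inj₂)
open import Data.Vec using (Vec; _∷_; lookup; replicate; zipWith; _[_]≔_)
open import Data.Vec.Properties
  using (lookup∘update; lookup∘update′; lookup-replicate; lookup-zipWith; zipWith-replicate;
         []≔-lookup; tabulate∘lookup; tabulate-cong; ≡-dec)
import Data.Vec.Functional as Functional
open import Function using (_∘_)
open import Function.Bundles using (_⇔_; mk⇔; Equivalence)
open import Function.Definitions using (Injective)
open import Relation.Binary.PropositionalEquality
open import Relation.Nullary using (¬_; yes; no)
open import Relation.Nullary.Decidable using (⌊_⌋; _×-dec_; ¬?; map′; decidable-stable)
open import Relation.Unary using (Decidable)

open Equivalence using (to; from)

m+n≤m⇒n≡0 : ∀ m {n} → m + n ≤ m → n ≡ 0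
m+n≤m⇒n≡0 m {n} m+n≤m =
  n≤0⇒n≡0 (+-cancelˡ-≤ m n 0 (subst (m + n ≤_) (sym (+-identityʳ m)) m+n≤m))

module _ {P : ℕ → Set} (P? : Decidable P) where

  largest-below : ∀ N → (∃ λ n → n < N × P n) →
                  ∃ λ m → P m × (∀ n → n < N → P n → n ≤ m)
  largest-below zero (_ , () , _)
  largest-below (suc N) (n , n<1+N , pn) with P? N
  ... | yes pN = N , pN , λ k k<1+N _ → ≤-pred k<1+N
  ... | no ¬pN =
    let m , pm , max = largest-below N (n , below pn n<1+N , pn)
    in m , pm , λ k k<1+N pk → max k (below pk k<1+N) pk
    where
    below : ∀ {k} → P k → k < suc N → k < N
    below pk k<1+N = ≤∧≢⇒< (≤-pred k<1+N) (λ k≡N → ¬pN (subst P k≡N pk))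

  largest : ∀ N → (∀ n → N ≤ n → ¬ P n) → ∃ P → ∃ λ m → P m × (∀ n → P n → n ≤ m)
  largest N bounded (n , pn) =
    let m , pm , max = largest-below N (n , below pn , pn)
    in m , pm , λ k pk → max k (below pk) pk
    where
    below : ∀ {k} → P k → k < N
    below {k} pk = ≰⇒> (λ N≤k → bounded k N≤k pk)

module _ (T : NumericalSemigroup) where

  gap? : Decidable (Gap T)
  gap? n = mem T n ≟ᵇ false

  ¬gap⇒mem : ∀ {n} → ¬ Gap T n → mem T n ≡ true
  ¬gap⇒mem = ¬-not

  ¬mem⇒gap : ∀ {n} → ¬ mem T n ≡ true → Gap T n
  ¬mem⇒gap = ¬-not

  mem⇒¬gap : ∀ {n} → mem T n ≡ true → ¬ Gap T n
  mem⇒¬gap = not-¬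

  gap⇒≢0 : ∀ {n} → Gap T n → n ≢ 0
  gap⇒≢0 g refl = mem⇒¬gap (zero-mem T) g

  frobenius : NotAllℕ T → Σ ℕ (IsFrobenius T)
  frobenius notℕ =
    let N , cofinal = cofinite T
    in largest gap? N (λ n N≤n → mem⇒¬gap (cofinal n N≤n)) notℕ

  frobenius-unique : ∀ {F G} → IsFrobenius T F → IsFrobenius T G → F ≡ G
  frobenius-unique (gF , maxF) (gG , maxG) = ≤-antisym (maxG _ gF) (maxF _ gG)

  frobenius+-mem : ∀ {F s} → IsFrobenius T F → s ≢ 0 → mem T (F + s) ≡ true
  frobenius+-mem {F} (_ , max) s≢0 = ¬gap⇒mem λ g → s≢0 (m+n≤m⇒n≡0 F (max _ g))

  frobenius-pseudoFrobenius : ∀ {F} → IsFrobenius T F → PseudoFrobenius T F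
  frobenius-pseudoFrobenius isF = proj₁ isF , λ _ _ → frobenius+-mem isF

  symmetric⇔ : ∀ {F} → IsFrobenius T F → Symmetric T ⇔ (∀ x → PseudoFrobenius T x → x ≡ F)
  symmetric⇔ {F} isF = mk⇔
    (λ (_ , isG , PF⇔G) x pf → trans (to (PF⇔G x) pf) (frobenius-unique isG isF))
    (λ PF≡F → F , isF , λ x → mk⇔ (PF≡F x) λ { refl → frobenius-pseudoFrobenius isF })

  SpecialGap : ℕ → Set
  SpecialGap x = PseudoFrobenius T x × mem T (x + x) ≡ true

  frobenius-special : ∀ {F} → IsFrobenius T F → SpecialGap F
  frobenius-special isF = frobenius-pseudoFrobenius isF , frobenius+-mem isF (gap⇒≢0 (proj₁ isF))

  -- T is symmetric or pseudo-symmetric with Frobenius number F.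
  Reflective : ℕ → Set
  Reflective F = ∀ h → Gap T h → h + h ≡ F ⊎ mem T (F ∸ h) ≡ true

  reflective-special⇒≡F : ∀ {F x} → IsFrobenius T F → Reflective F → SpecialGap x → x ≡ F
  reflective-special⇒≡F {F} {x} (gF , max) reflective ((gx , x+∈T) , 2x∈T)
    with x ≟ F | reflective x gx
  ... | yes x≡F | _ = x≡F
  ... | no _ | inj₁ 2x≡F = ⊥-elim (mem⇒¬gap (trans (cong (mem T) (sym 2x≡F)) 2x∈T) gF)
  ... | no x≢F | inj₂ F∸x∈T =
    ⊥-elim (mem⇒¬gap (trans (cong (mem T) (sym (m+[n∸m]≡n x≤F))) (x+∈T _ F∸x∈T F∸x≢0)) gF)
    where
    x≤F : x ≤ F
    x≤F = max x gx
    F∸x≢0 : F ∸ x ≢ 0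
    F∸x≢0 F∸x≡0 = x≢F (≤-antisym x≤F (m∸n≡0⇒m≤n F∸x≡0))

  mem∪ : ℕ → ℕ → Bool
  mem∪ x n = mem T n ∨ ⌊ n ≟ x ⌋

  mem∪-intro : ∀ {x n} → mem T n ≡ true ⊎ n ≡ x → mem∪ x n ≡ true
  mem∪-intro (inj₁ n∈T) = cong (_∨ _) n∈T
  mem∪-intro {x} (inj₂ refl) with x ≟ x
  ... | yes _ = ∨-zeroʳ (mem T x)
  ... | no x≢x = ⊥-elim (x≢x refl)

  mem∪-elim : ∀ {x n} → mem∪ x n ≡ true → mem T n ≡ true ⊎ n ≡ x
  mem∪-elim {x} {n} n∈ with mem T n | n ≟ x
  ... | true | _ = inj₁ refl
  ... | false | yes n≡x = inj₂ n≡x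
  mem∪-elim () | false | no _

  adjoin : ∀ x → SpecialGap x → NumericalSemigroup
  adjoin x ((_ , x+∈T) , 2x∈T) = record
    { mem      = mem∪ x
    ; zero-mem = mem∪-intro (inj₁ (zero-mem T))
    ; +-closed = closed
    ; cofinite = let N , cofinal = cofinite T in N , λ n N≤n → mem∪-intro (inj₁ (cofinal n N≤n))
    }
    where
    x+ : ∀ s → mem T s ≡ true → mem∪ x (x + s) ≡ true
    x+ s s∈T with s ≟ 0
    ... | yes refl = mem∪-intro (inj₂ (+-identityʳ x))
    ... | no s≢0 = mem∪-intro (inj₁ (x+∈T s s∈T s≢0))
    closed : ∀ a b → mem∪ x a ≡ true → mem∪ x b ≡ true → mem∪ x (a + b) ≡ true
    closed a b a∈ b∈ with mem∪-elim a∈ | mem∪-elim b∈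
    ... | inj₁ a∈T | inj₁ b∈T = mem∪-intro (inj₁ (+-closed T a b a∈T b∈T))
    ... | inj₂ refl | inj₁ b∈T = x+ b b∈T
    ... | inj₁ a∈T | inj₂ refl = subst (λ n → mem∪ x n ≡ true) (+-comm x a) (x+ a a∈T)
    ... | inj₂ refl | inj₂ refl = mem∪-intro (inj₁ 2x∈T)

  ⊂adjoin : ∀ {x} (sx : SpecialGap x) → T ⊂NS adjoin x sx
  ⊂adjoin {x} sx =
    (λ _ n∈T → mem∪-intro (inj₁ n∈T)) , x , mem∪-intro (inj₂ refl) , proj₁ (proj₁ sx)

  ∩-adjoin : ∀ {x y} → x ≢ y → ∀ n → mem T n ≡ (mem∪ x n ∧ mem∪ y n)
  ∩-adjoin {x} {y} x≢y n with mem T n | n ≟ x | n ≟ y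
  ... | true | _ | _ = refl
  ... | false | no _ | _ = refl
  ... | false | yes _ | no _ = refl
  ... | false | yes refl | yes refl = ⊥-elim (x≢y refl)

-- x + s ∈ T' exceeds the largest element x of T' ∖ T, so it lies in T.
largest-new⇒special : ∀ T T' {x} → (∀ n → mem T n ≡ true → mem T' n ≡ true) →
                      mem T' x ≡ true → Gap T x → (∀ n → mem T' n ≡ true × Gap T n → n ≤ x) →
                      SpecialGap T x
largest-new⇒special T T' {x} T⊆T' x∈T' gx max =
  (gx , λ s s∈T → x+∈T s (T⊆T' s s∈T)) , x+∈T x x∈T' (gap⇒≢0 T gx)
  where
  x+∈T : ∀ s → mem T' s ≡ true → s ≢ 0 → mem T (x + s) ≡ true
  x+∈T s s∈T' s≢0 =
    ¬gap⇒mem T λ g → s≢0 (m+n≤m⇒n≡0 x (max _ (+-closed T' x s x∈T' s∈T' , g)))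

⊂⇒special : ∀ T T' → T ⊂NS T' → ∃ λ x → mem T' x ≡ true × SpecialGap T x
⊂⇒special T T' (T⊆T' , new) =
  let N , cofinal = cofinite T
      x , (x∈T' , gx) , max = largest {P = λ n → mem T' n ≡ true × Gap T n}
        (λ n → (mem T' n ≟ᵇ true) ×-dec gap? T n) N
        (λ n N≤n (_ , g) → mem⇒¬gap T (cofinal n N≤n) g) new
  in x , x∈T' , largest-new⇒special T T' T⊆T' x∈T' gx max

reflective⇒irreducible : ∀ T {F} → IsFrobenius T F → Reflective T F → Irreducible T
reflective⇒irreducible T {F} isF reflective (T₁ , T₂ , T⊂T₁ , T⊂T₂ , T≡T₁∩T₂) =
  mem⇒¬gap T (trans (T≡T₁∩T₂ F) (cong₂ _∧_ (F∈ T₁ T⊂T₁) (F∈ T₂ T⊂T₂))) (proj₁ isF)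
  where
  F∈ : ∀ T' → T ⊂NS T' → mem T' F ≡ true
  F∈ T' T⊂T' =
    let x , x∈T' , sx = ⊂⇒special T T' T⊂T'
    in trans (cong (mem T') (sym (reflective-special⇒≡F T isF reflective sx))) x∈T'

module _ (T : NumericalSemigroup) {F : ℕ} (isF : IsFrobenius T F) where

  Unpaired : ℕ → Set
  Unpaired n = Gap T n × Gap T (F ∸ n) × n + n ≢ F

  unpaired? : Decidable Unpaired
  unpaired? n = gap? T n ×-dec gap? T (F ∸ n) ×-dec ¬? (n + n ≟ F)

  unpaired-reflect : ∀ {n} → Unpaired n → Unpaired (F ∸ n)
  unpaired-reflect {n} (gn , gF∸n , 2n≢F) =
    gF∸n , subst (Gap T) (sym (m∸[m∸n]≡n n≤F)) gn , λ e → 2n≢F (2n≡F e)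
    where
    n≤F : n ≤ F
    n≤F = proj₂ isF n gn
    F∸n+n : F ∸ n + n ≡ F
    F∸n+n = m∸n+n≡m n≤F
    2n≡F : (F ∸ n) + (F ∸ n) ≡ F → n + n ≡ F
    2n≡F e = trans (cong (_+ n) (sym (+-cancelˡ-≡ (F ∸ n) _ _ (trans e (sym F∸n+n))))) F∸n+n

  unpaired-+ : ∀ {x s} → Unpaired x → F < x + x → mem T s ≡ true → Gap T (x + s) →
               Unpaired (x + s)
  unpaired-+ {x} {s} (_ , gF∸x , _) F<2x s∈T gx+s =
    gx+s , gF∸[x+s] , λ e → <⇒≱ F<2x (2x≤F e)
    where
    s≤F∸x : s ≤ F ∸ x
    s≤F∸x = m+n≤o⇒m≤o∸n s (subst (_≤ F) (+-comm x s) (proj₂ isF _ gx+s))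
    -- F − x = (F − (x + s)) + s would lie in T otherwise
    gF∸[x+s] : Gap T (F ∸ (x + s))
    gF∸[x+s] = ¬mem⇒gap T λ m →
      mem⇒¬gap T (trans (cong (mem T) (sym F∸x≡)) (+-closed T _ s m s∈T)) gF∸x
      where
      F∸x≡ : F ∸ (x + s) + s ≡ F ∸ x
      F∸x≡ = trans (cong (_+ s) (sym (∸-+-assoc F x s))) (m∸n+n≡m s≤F∸x)
    2x≤F : (x + s) + (x + s) ≡ F → x + x ≤ F
    2x≤F e = subst (x + x ≤_) e (+-mono-≤ (m≤m+n x s) (m≤m+n x s))

  -- The largest unpaired x is at least F − x, also unpaired, so 2x > F.
  unpaired⇒special : ∀ {h} → Unpaired h → ∃ λ x → SpecialGap T x × x ≢ F
  unpaired⇒special uh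
    with x , ux , max ←
           largest unpaired? (suc F) (λ n F<n u → <⇒≱ F<n (proj₂ isF n (proj₁ u))) (_ , uh)
    = x , ((gx , x+∈T) , 2x∈T) , x≢F
    where
    gx : Gap T x
    gx = proj₁ ux
    F<2x : F < x + x
    F<2x = ≤∧≢⇒< (subst (_≤ x + x) (m∸n+n≡m (proj₂ isF x gx))
                         (+-monoˡ-≤ x (max _ (unpaired-reflect ux))))
                 (≢-sym (proj₂ (proj₂ ux)))
    2x∈T : mem T (x + x) ≡ true
    2x∈T = ¬gap⇒mem T λ g → <⇒≱ F<2x (proj₂ isF _ g)
    x+∈T : ∀ s → mem T s ≡ true → s ≢ 0 → mem T (x + s) ≡ true
    x+∈T s s∈T s≢0 = ¬gap⇒mem T λ g → s≢0 (m+n≤m⇒n≡0 x (max _ (unpaired-+ ux F<2x s∈T g)))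
    x≢F : x ≢ F
    x≢F refl = gap⇒≢0 T (proj₁ (proj₂ ux)) (n∸n≡0 x)

irreducible⇒reflective : ∀ T {F} → IsFrobenius T F → Irreducible T → Reflective T F
irreducible⇒reflective T {F} isF irreducible h gh with h + h ≟ F | gap? T (F ∸ h)
... | yes 2h≡F | _ = inj₁ 2h≡F
... | no _ | no ¬gF∸h = inj₂ (¬gap⇒mem T ¬gF∸h)
... | no 2h≢F | yes gF∸h with x , sx , x≢F ← unpaired⇒special T isF (gh , gF∸h , 2h≢F) =
  ⊥-elim (irreducible (adjoin T x sx , adjoin T F sF , ⊂adjoin T sx , ⊂adjoin T sF , ∩-adjoin T x≢F))
  where
  sF : SpecialGap T F
  sF = frobenius-special T isF

lookup-extensional : ∀ {n} {x y : Vec ℕ n} → (∀ k → lookup x k ≡ lookup y k) → x ≡ y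
lookup-extensional {x = x} {y} x≗y =
  trans (sym (tabulate∘lookup x)) (trans (tabulate-cong x≗y) (tabulate∘lookup y))

lookup-·e-same : ∀ {d} h (i : Fin d) → lookup (h ·e i) i ≡ h
lookup-·e-same h i = lookup∘update i 0ᵥ h

lookup-·e-other : ∀ {d} h {i j : Fin d} → j ≢ i → lookup (h ·e i) j ≡ 0
lookup-·e-other h {i} {j} j≢i = trans (lookup∘update′ j≢i 0ᵥ h) (lookup-replicate j 0)

0·e≡0ᵥ : ∀ {d} (i : Fin d) → 0 ·e i ≡ 0ᵥ
0·e≡0ᵥ i = trans (cong (0ᵥ [ i ]≔_) (sym (lookup-replicate i 0))) ([]≔-lookup 0ᵥ i)

·e-zipWith : ∀ {d} (f : ℕ → ℕ → ℕ) → f 0 0 ≡ 0 → ∀ a b (i : Fin d) →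
             zipWith f (a ·e i) (b ·e i) ≡ f a b ·e i
·e-zipWith f f00 a b zero =
  cong (f a b ∷_) (trans (zipWith-replicate f 0 0) (cong (replicate _) f00))
·e-zipWith f f00 a b (suc i) = cong₂ _∷_ f00 (·e-zipWith f f00 a b i)

·e-+ᵥ : ∀ {d} a b (i : Fin d) → (a ·e i) +ᵥ (b ·e i) ≡ (a + b) ·e i
·e-+ᵥ = ·e-zipWith _+_ refl

·e-∸ᵥ : ∀ {d} a b (i : Fin d) → (a ·e i) ∸ᵥ (b ·e i) ≡ (a ∸ b) ·e i
·e-∸ᵥ = ·e-zipWith _∸_ refl

·e-mono : ∀ {d a b} {i : Fin d} → a ≤ b → (a ·e i) ≤ᵥ (b ·e i)
·e-mono {a = a} {b} {i} a≤b j with j ≟ᶠ i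
... | yes refl = subst₂ _≤_ (sym (lookup-·e-same a j)) (sym (lookup-·e-same b j)) a≤b
... | no j≢i = subst (_≤ _) (sym (lookup-·e-other a j≢i)) z≤n

·e-≤ᵥ : ∀ {d a b} {i j : Fin d} → a ≢ 0 → (a ·e i) ≤ᵥ (b ·e j) → i ≡ j × a ≤ b
·e-≤ᵥ {a = a} {b} {i} {j} a≢0 le with i ≟ᶠ j
... | yes refl = refl , subst₂ _≤_ (lookup-·e-same a i) (lookup-·e-same b i) (le i)
... | no i≢j =
  ⊥-elim (a≢0 (n≤0⇒n≡0 (subst₂ _≤_ (lookup-·e-same a i) (lookup-·e-other b i≢j) (le i))))

·e-injective : ∀ {d a b} {i j : Fin d} → a ≢ 0 → a ·e i ≡ b ·e j → i ≡ j × a ≡ b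
·e-injective {a = a} {b} {i} a≢0 e
  with refl , _ ← ·e-≤ᵥ a≢0 (λ k → ≤-reflexive (cong (λ v → lookup v k) e))
  = refl , trans (sym (lookup-·e-same a i)) (trans (cong (λ v → lookup v i) e) (lookup-·e-same b i))

·e≢0ᵥ : ∀ {d a} {i : Fin d} → a ≢ 0 → a ·e i ≢ 0ᵥ
·e≢0ᵥ {i = i} a≢0 e = a≢0 (proj₂ (·e-injective a≢0 (trans e (sym (0·e≡0ᵥ i)))))

onAxis : ∀ {d} (x : Vec ℕ d) (i : Fin d) → (∀ k → k ≢ i → lookup x k ≡ 0) → x ≡ lookup x i ·e i
onAxis x i off = lookup-extensional coordinate
  where
  coordinate : ∀ k → lookup x k ≡ lookup (lookup x i ·e i) k
  coordinate k with k ≟ᶠ i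
  ... | yes refl = sym (lookup-·e-same _ k)
  ... | no k≢i = trans (off k k≢i) (sym (lookup-·e-other _ k≢i))

≤ᵥ-+ᵥ : ∀ {d} (x y : Vec ℕ d) → x ≤ᵥ (x +ᵥ y)
≤ᵥ-+ᵥ x y k = subst (lookup x k ≤_) (sym (lookup-zipWith _+_ k x y)) (m≤m+n _ _)

AxisGap : ∀ {d} → (Fin d → NumericalSemigroup) → Vec ℕ d → Set
AxisGap {d} T x = Σ (Fin d) λ i → Σ ℕ λ h → Gap (T i) h × x ≡ h ·e i

module _ {d : ℕ} (T : Fin d → NumericalSemigroup) where

  private
    S : Vec ℕ d → Set
    S = SemigroupFrom T

  axisGap? : Decidable (AxisGap T)
  axisGap? x = map′ (λ (i , g , e) → i , lookup x i , g , e) coordinates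
    (any? λ i → gap? (T i) (lookup x i) ×-dec ≡-dec _≟_ x (lookup x i ·e i))
    where
    coordinates : AxisGap T x → ∃ λ i → Gap (T i) (lookup x i) × x ≡ lookup x i ·e i
    coordinates (i , h , g , refl) =
      i , subst (Gap (T i)) (sym (lookup-·e-same h i)) g , cong (_·e i) (sym (lookup-·e-same h i))

  gap⇒axisGap : ∀ {x} → GapV S x → AxisGap T x
  gap⇒axisGap {x} = decidable-stable (axisGap? x)

  axisGap⇒gap : ∀ {i h} → Gap (T i) h → GapV S (h ·e i)
  axisGap⇒gap {i} {h} g s = s (i , h , g , refl)

  mem⇒onAxis : ∀ {i m} → mem (T i) m ≡ true → S (m ·e i)
  mem⇒onAxis m∈ (j , h , gh , e) with refl , refl ← ·e-injective (gap⇒≢0 (T j) gh) (sym e) =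
    mem⇒¬gap (T j) m∈ gh

  onAxis⇒mem : ∀ {i m} → S (m ·e i) → mem (T i) m ≡ true
  onAxis⇒mem {i} {m} s = ¬gap⇒mem (T i) λ g → s (i , m , g , refl)

  axisGap-+ᵥ : ∀ {i h} y → h ≢ 0 → AxisGap T ((h ·e i) +ᵥ y) →
               ∃ λ t → y ≡ t ·e i × Gap (T i) (h + t)
  axisGap-+ᵥ {i} {h} y h≢0 (j , h′ , g , e)
    with refl , _ ← ·e-≤ᵥ h≢0 (subst ((h ·e i) ≤ᵥ_) e (≤ᵥ-+ᵥ (h ·e i) y))
    = lookup y i , onAxis y i off , subst (Gap (T i)) (sym h+yᵢ≡h′) g
    where
    coordinate : ∀ k → lookup (h ·e i) k + lookup y k ≡ lookup (h′ ·e i) k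
    coordinate k = trans (sym (lookup-zipWith _+_ k (h ·e i) y)) (cong (λ v → lookup v k) e)
    off : ∀ k → k ≢ i → lookup y k ≡ 0
    off k k≢i = trans (cong (_+ lookup y k) (sym (lookup-·e-other h k≢i)))
                      (trans (coordinate k) (lookup-·e-other h′ k≢i))
    h+yᵢ≡h′ : h + lookup y i ≡ h′
    h+yᵢ≡h′ = trans (cong (_+ lookup y i) (sym (lookup-·e-same h i)))
                    (trans (coordinate i) (lookup-·e-same h′ i))

  pseudoFrobenius⇒PF : ∀ {i h} → PseudoFrobenius (T i) h → PF S (h ·e i)
  pseudoFrobenius⇒PF {i} {h} (gh , h+∈T) = axisGap⇒gap gh , λ s s∈S s≢0 gap →
    let t , s≡t·e , gh+t = axisGap-+ᵥ s (gap⇒≢0 (T i) gh) gap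
        t∈T = onAxis⇒mem (subst S s≡t·e s∈S)
        t≢0 = λ t≡0 → s≢0 (trans s≡t·e (trans (cong (_·e i) t≡0) (0·e≡0ᵥ i)))
    in mem⇒¬gap (T i) (h+∈T t t∈T t≢0) gh+t

  PF⇒pseudoFrobenius : ∀ {i h} → PF S (h ·e i) → Gap (T i) h → PseudoFrobenius (T i) h
  PF⇒pseudoFrobenius {i} {h} (_ , pf) gh = gh , λ s s∈T s≢0 →
    onAxis⇒mem (subst S (·e-+ᵥ h s i) (pf (s ·e i) (mem⇒onAxis s∈T) (·e≢0ᵥ s≢0)))

unique⇒lookup-injective : ∀ {A : Set} {xs : List A} → Unique xs → Injective _≡_ _≡_ (lookupˡ xs)
unique⇒lookup-injective (_ ∷ _) {zero} {zero} _ = refl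
unique⇒lookup-injective (x∉ ∷ _) {zero} {suc j} e = ⊥-elim (lookupᴬ x∉ (∈-lookup j) e)
unique⇒lookup-injective (x∉ ∷ _) {suc i} {zero} e = ⊥-elim (lookupᴬ x∉ (∈-lookup i) (sym e))
unique⇒lookup-injective (_ ∷ u) {suc i} {suc j} e = cong suc (unique⇒lookup-injective u e)

module _ {d : ℕ} {P : Vec ℕ d → Set} where

  hasCard-image : ∀ {m} (e : Fin m → Vec ℕ d) → Injective _≡_ _≡_ e →
                  (∀ k → P (e k)) → (∀ x → P x → ∃[ k ] x ≡ e k) → HasCard P m
  hasCard-image e e-injective P-e P⇒image =
    tabulate e , tabulate⁺ e-injective , (λ x → mk⇔ image⇒P (image⇐P x)) , length-tabulate e
    where
    image⇒P : ∀ {x} → x ∈ tabulate e → P x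
    image⇒P x∈ = let k , x≡ek = ∈-tabulate⁻ x∈ in subst P (sym x≡ek) (P-e k)
    image⇐P : ∀ x → P x → x ∈ tabulate e
    image⇐P x px = let k , x≡ek = P⇒image x px in subst (_∈ tabulate e) (sym x≡ek) (∈-tabulate⁺ k)

  injection⇒≤card : ∀ {m n} (e : Fin m → Vec ℕ d) → Injective _≡_ _≡_ e →
                    (∀ k → P (e k)) → HasCard P n → m ≤ n
  injection⇒≤card e e-injective P-e (l , _ , l⇔P , refl) = injective⇒≤ position-injective
    where
    position : Fin _ → Fin (length l)
    position k = index (from (l⇔P (e k)) (P-e k))
    position-injective : Injective _≡_ _≡_ position
    position-injective {k} {k′} eq =
      e-injective (index-injective (setoid _) (from (l⇔P _) (P-e k)) (from (l⇔P _) (P-e k′)) eq)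

  hasCard-unique : ∀ {m n} → HasCard P m → HasCard P n → m ≡ n
  hasCard-unique cm cn = ≤-antisym (≤card cm cn) (≤card cn cm)
    where
    ≤card : ∀ {m n} → HasCard P m → HasCard P n → m ≤ n
    ≤card (l , l-unique , l⇔P , refl) =
      injection⇒≤card (lookupˡ l) (unique⇒lookup-injective l-unique) (λ k → to (l⇔P _) (∈-lookup k))

module _ {d : ℕ} (T : Fin d → NumericalSemigroup) {F : Fin d → ℕ}
         (isF : ∀ i → IsFrobenius (T i) (F i)) where

  private
    S : Vec ℕ d → Set
    S = SemigroupFrom T

  frobeniusVector : Fin d → Vec ℕ d
  frobeniusVector i = F i ·e i

  frobeniusVector-injective : Injective _≡_ _≡_ frobeniusVector
  frobeniusVector-injective e = proj₁ (·e-injective (gap⇒≢0 (T _) (proj₁ (isF _))) e)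

  FA-frobeniusVector : ∀ i → FA S (frobeniusVector i)
  FA-frobeniusVector i = axisGap⇒gap T (proj₁ (isF i)) , λ y gy → maximal (gap⇒axisGap T gy)
    where
    maximal : ∀ {y} → AxisGap T y → frobeniusVector i ≤ᵥ y → y ≡ frobeniusVector i
    maximal (j , h , gh , refl) le with refl , F≤h ← ·e-≤ᵥ (gap⇒≢0 (T i) (proj₁ (isF i))) le =
      cong (_·e i) (≤-antisym (proj₂ (isF i) h gh) F≤h)

  FA⇒frobeniusVector : ∀ x → FA S x → ∃[ i ] x ≡ frobeniusVector i
  FA⇒frobeniusVector x (gx , max) with gap⇒axisGap T gx
  ... | i , h , gh , refl =
    i , sym (max _ (axisGap⇒gap T (proj₁ (isF i))) (·e-mono (proj₂ (isF i) h gh)))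

  quasiIrreducible⇒reflective : QuasiIrreducible S → ∀ i → Reflective (T i) (F i)
  quasiIrreducible⇒reflective qi i h gh with qi (h ·e i) (axisGap⇒gap T gh)
  ... | inj₁ fa
    with j , e ← FA⇒frobeniusVector _ (subst (FA S) (·e-+ᵥ h h i) fa)
    with refl , 2h≡F ← ·e-injective (gap⇒≢0 (T i) gh ∘ m+n≡0⇒m≡0 h) e
    = inj₁ 2h≡F
  ... | inj₂ (_ , fa , h≤G , G∸h∈S)
    with j , refl ← FA⇒frobeniusVector _ fa
    with refl , _ ← ·e-≤ᵥ (gap⇒≢0 (T i) gh) h≤G
    = inj₂ (onAxis⇒mem T (subst S (·e-∸ᵥ (F i) h i) G∸h∈S))

  reflective⇒quasiIrreducible : (∀ i → Reflective (T i) (F i)) → QuasiIrreducible S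
  reflective⇒quasiIrreducible reflective x gx with gap⇒axisGap T gx
  ... | i , h , gh , refl with reflective i h gh
  ...   | inj₁ 2h≡F =
    inj₁ (subst (FA S) (sym (trans (·e-+ᵥ h h i) (cong (_·e i) 2h≡F))) (FA-frobeniusVector i))
  ...   | inj₂ F∸h∈T =
    inj₂ ( frobeniusVector i , FA-frobeniusVector i , ·e-mono (proj₂ (isF i) h gh)
         , subst S (sym (·e-∸ᵥ (F i) h i)) (mem⇒onAxis T F∸h∈T))

  quasiIrreducible⇔irreducible : QuasiIrreducible S ⇔ (∀ i → Irreducible (T i))
  quasiIrreducible⇔irreducible = mk⇔
    (λ qi i → reflective⇒irreducible (T i) (isF i) (quasiIrreducible⇒reflective qi i))
    (λ irreducible →
      reflective⇒quasiIrreducible λ i → irreducible⇒reflective (T i) (isF i) (irreducible i))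

  FA-card : HasCard (FA S) d
  FA-card = hasCard-image frobeniusVector frobeniusVector-injective FA-frobeniusVector FA⇒frobeniusVector

  symmetric⇒quasiSymmetric : (∀ i x → PseudoFrobenius (T i) x → x ≡ F i) → QuasiSymmetric S
  symmetric⇒quasiSymmetric PF≡F = d , FA-card ,
    hasCard-image frobeniusVector frobeniusVector-injective
      (λ i → pseudoFrobenius⇒PF T (frobenius-pseudoFrobenius (T i) (isF i))) PF⇒frobeniusVector
    where
    PF⇒frobeniusVector : ∀ x → PF S x → ∃[ i ] x ≡ frobeniusVector i
    PF⇒frobeniusVector x pf with gap⇒axisGap T (proj₁ pf)
    ... | i , h , gh , refl = i , cong (_·e i) (PF≡F i h (PF⇒pseudoFrobenius T pf gh))

  quasiSymmetric⇒symmetric : QuasiSymmetric S → ∀ i x → PseudoFrobenius (T i) x → x ≡ F i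
  quasiSymmetric⇒symmetric (n , FA-n , PF-n) i x pfx = decidable-stable (x ≟ F i) λ x≢F →
    <⇒≱ (injection⇒≤card extended (extended-injective x≢F) extended-PF PF-n)
        (≤-reflexive (sym (hasCard-unique FA-card FA-n)))
    where
    extended : Fin (suc d) → Vec ℕ d
    extended = (x ·e i) Functional.∷ frobeniusVector
    extended-PF : ∀ k → PF S (extended k)
    extended-PF zero = pseudoFrobenius⇒PF T pfx
    extended-PF (suc j) = pseudoFrobenius⇒PF T (frobenius-pseudoFrobenius (T j) (isF j))
    x≢0 : x ≢ 0
    x≢0 = gap⇒≢0 (T i) (proj₁ pfx)
    extended-injective : x ≢ F i → Injective _≡_ _≡_ extended
    extended-injective _ {zero} {zero} _ = refl
    extended-injective x≢F {zero} {suc j} e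
      with refl , x≡F ← ·e-injective x≢0 e = ⊥-elim (x≢F x≡F)
    extended-injective x≢F {suc j} {zero} e
      with refl , x≡F ← ·e-injective x≢0 (sym e) = ⊥-elim (x≢F x≡F)
    extended-injective _ {suc j} {suc k} e = cong suc (frobeniusVector-injective e)

  quasiSymmetric⇔symmetric : QuasiSymmetric S ⇔ (∀ i → Symmetric (T i))
  quasiSymmetric⇔symmetric = mk⇔
    (λ qs i → from (symmetric⇔ (T i) (isF i)) (quasiSymmetric⇒symmetric qs i))
    (λ symmetric → symmetric⇒quasiSymmetric λ i → to (symmetric⇔ (T i) (isF i)) (symmetric i))

proposition5p6 : (d : ℕ) → 1 ≤ d → (T : Fin d → NumericalSemigroup) →
    (∀ i → NotAllℕ (T i)) →
    (QuasiIrreducible (SemigroupFrom T) ⇔ (∀ i → Irreducible (T i)))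
    × (QuasiSymmetric (SemigroupFrom T) ⇔ (∀ i → Symmetric (T i)))
proposition5p6 d _ T notℕ = quasiIrreducible⇔irreducible T isF , quasiSymmetric⇔symmetric T isF
  where
  isF : ∀ i → IsFrobenius (T i) (proj₁ (frobenius (T i) (notℕ i)))
  isF i = proj₂ (frobenius (T i) (notℕ i))
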